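{- Let $\mathcal L$ be a summable category (in the sense of the context) and let $f_{00},f_{01},f_{10},f_{11}\in\mathcal L(X,Y)$ be such that $(f_{00},f_{01})$ and $(f_{10},f_{11})$ are summable, and moreover $(f_{00}+f_{01},f_{10}+f_{11})$ is summable. Then $(f_{00},f_{10})$ and $(f_{01},f_{11})$ are summable, $(f_{00}+f_{10},f_{01}+f_{11})$ is summable, and $$(f_{00}+f_{01})+(f_{10}+f_{11})=(f_{00}+f_{10})+(f_{01}+f_{11}).$$
   Context: Let $\mathcal L$ be a category enriched over pointed sets: every hom-set $\mathcal L(X,Y)$ has a distinguished morphism $0$ with $g\circ 0=0$ and $0\circ f=0$. A pre-summability structure on $\mathcal L$ is a tuple $(S,\pi_0,\pi_1,\sigma)$ where $S:\mathcal L\to\mathcal L$ is a functor with $S0=0$ and $\pi_0,\pi_1,\sigma$ are natural transformations from $S$ to the identity functor, with $\pi_0,\pi_1$ jointly monic (if $\pi_i\circ f=\pi_i\circ g$ for $i=0,1$ then $f=g$). Two morphisms $f_0,f_1\in\mathcal L(X,Y)$ are summable if there is $g\in\mathcal L(X,SY)$ with $\pi_i\circ g=f_i$ for $i=0,1$; this $g$ is then unique, is called the witness and written $\langle f_0,f_1\rangle_S$, and the sum is $f_0+f_1:=\sigma_Y\circ\langle f_0,f_1\rangle_S$. A summability structure is a pre-summability structure satisfying: (S-com) $\pi_1,\pi_0$ are summable and $\sigma\circ\langle\pi_1,\pi_0\rangle_S=\sigma$; (S-zero) for every $f\in\mathcal L(X,Y)$, $f$ and $0$ are summable and $f+0=f$;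 (S-witness) whenever $(f_{00},f_{01})$ and $(f_{10},f_{11})$ are summable pairs in $\mathcal L(X,Y)$ such that $(f_{00}+f_{01},f_{10}+f_{11})$ is summable, the witnesses $\langle f_{00},f_{01}\rangle_S,\langle f_{10},f_{11}\rangle_S\in\mathcal L(X,SY)$ are summable; (S-assoc) $S(\sigma_X)\circ c_X=\sigma_{SX}$, where $c_X\in\mathcal L(S^2X,S^2X)$ is the unique morphism with $\pi_{i,X}\circ\pi_{j,SX}\circ c_X=\pi_{j,X}\circ\pi_{i,SX}$ for all $i,j\in\{0,1\}$ (it exists under the previous axioms, as the witness $\langle\langle\pi_0\pi_0,\pi_0\pi_1\rangle_S,\langle\pi_1\pi_0,\pi_1\pi_1\rangle_S\rangle_S$). A summable category is a category equipped with a summability structure. -}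

module Defs where

open import Level using (Level; _⊔_; suc)
open import Data.Product using (Σ; _×_; _,_; proj₁; proj₂)
open import Relation.Binary.PropositionalEquality using (_≡_)

record PointedCategory (o ℓ : Level) : Set (suc (o ⊔ ℓ)) where
  infixr 9 _∘_
  field
    Obj  : Set o
    Hom  : Obj → Obj → Set ℓ
    id   : ∀ {X} → Hom X X
    _∘_  : ∀ {X Y Z} → Hom Y Z → Hom X Y → Hom X Z
    identityˡ : ∀ {X Y} {f : Hom X Y} → id ∘ f ≡ f
    identityʳ : ∀ {X Y} {f : Hom X Y} → f ∘ id ≡ f
    assoc : ∀ {W X Y Z} {f : Hom W X} {g : Hom X Y} {h : Hom Y Z} →
            (h ∘ g) ∘ f ≡ h ∘ (g ∘ f)
    0m   : ∀ {X Y} → Hom X Y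
    zeroˡ : ∀ {X Y Z} {f : Hom X Y} → (0m {Y} {Z}) ∘ f ≡ 0m
    zeroʳ : ∀ {X Y Z} {g : Hom Y Z} → g ∘ (0m {X} {Y}) ≡ 0m

record PreSummability {o ℓ} (𝓛 : PointedCategory o ℓ) : Set (o ⊔ ℓ) where
  open PointedCategory 𝓛
  field
    S₀ : Obj → Obj
    S₁ : ∀ {X Y} → Hom X Y → Hom (S₀ X) (S₀ Y)
    S-id : ∀ {X} → S₁ (id {X}) ≡ id
    S-∘  : ∀ {X Y Z} {f : Hom X Y} {g : Hom Y Z} → S₁ (g ∘ f) ≡ S₁ g ∘ S₁ f
    S-0  : ∀ {X Y} → S₁ (0m {X} {Y}) ≡ 0m
    π₀ π₁ σ : ∀ X → Hom (S₀ X) X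
    π₀-nat : ∀ {X Y} (f : Hom X Y) → f ∘ π₀ X ≡ π₀ Y ∘ S₁ f
    π₁-nat : ∀ {X Y} (f : Hom X Y) → f ∘ π₁ X ≡ π₁ Y ∘ S₁ f
    σ-nat  : ∀ {X Y} (f : Hom X Y) → f ∘ σ X ≡ σ Y ∘ S₁ f
    jointly-monic : ∀ {X Y} {f g : Hom X (S₀ Y)} →
      π₀ Y ∘ f ≡ π₀ Y ∘ g → π₁ Y ∘ f ≡ π₁ Y ∘ g → f ≡ g

  Summable : ∀ {X Y} → Hom X Y → Hom X Y → Set ℓ
  Summable {X} {Y} f₀ f₁ =
    Σ (Hom X (S₀ Y)) λ g → (π₀ Y ∘ g ≡ f₀) × (π₁ Y ∘ g ≡ f₁)

  witness : ∀ {X Y} {f₀ f₁ : Hom X Y} → Summable f₀ f₁ → Hom X (S₀ Y)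
  witness = proj₁

  sum : ∀ {X Y} {f₀ f₁ : Hom X Y} → Summable f₀ f₁ → Hom X Y
  sum {X} {Y} p = σ Y ∘ witness p

record Summability {o ℓ} (𝓛 : PointedCategory o ℓ) : Set (o ⊔ ℓ) where
  open PointedCategory 𝓛
  field
    pre : PreSummability 𝓛
  open PreSummability pre
  field
    S-com : ∀ X → Σ (Summable (π₁ X) (π₀ X)) λ p → sum p ≡ σ X
    S-zero : ∀ {X Y} (f : Hom X Y) → Σ (Summable f 0m) λ p → sum p ≡ f
    S-witness : ∀ {X Y} {f₀₀ f₀₁ f₁₀ f₁₁ : Hom X Y}
      (p₀ : Summable f₀₀ f₀₁) (p₁ : Summable f₁₀ f₁₁) →
      Summable (sum p₀) (sum p₁) →
      Summable (witness p₀) (witness p₁)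
    -- c_X is the unique morphism with π_{i,X} ∘ π_{j,SX} ∘ c = π_{j,X} ∘ π_{i,SX}
    S-assoc : ∀ X (c : Hom (S₀ (S₀ X)) (S₀ (S₀ X))) →
      (π₀ X ∘ π₀ (S₀ X) ∘ c ≡ π₀ X ∘ π₀ (S₀ X)) →
      (π₀ X ∘ π₁ (S₀ X) ∘ c ≡ π₁ X ∘ π₀ (S₀ X)) →
      (π₁ X ∘ π₀ (S₀ X) ∘ c ≡ π₀ X ∘ π₁ (S₀ X)) →
      (π₁ X ∘ π₁ (S₀ X) ∘ c ≡ π₁ X ∘ π₁ (S₀ X)) →
      S₁ (σ X) ∘ c ≡ σ (S₀ X)

{-# OPTIONS --safe #-}
-- Applying S-witness to the two rows yields a "double witness" W : X → S²Y of
-- the 2×2 matrix (f_ij). Post-composing W with S π_j gives witnesses of the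
-- columns, and precomposing the transposition c gives a double witness of the
-- transposed matrix. Both iterated sums then equal σ ∘ σ_S ∘ W: for the rows by
-- naturality of σ, for the columns by S-assoc, which says S σ ∘ c = σ_S.
module Submission where

open import Defs
open import Level using (_⊔_)
open import Data.Product using (Σ; _,_)
open import Relation.Binary.PropositionalEquality
  using (_≡_; sym; trans; cong; module ≡-Reasoning)

module PreSummabilityProperties {o ℓ} {𝓛 : PointedCategory o ℓ}
                                (Pre : PreSummability 𝓛) where
  open PointedCategory 𝓛
  open PreSummability Pre
  open ≡-Reasoning

  NaturalToId : (∀ Z → Hom (S₀ Z) Z) → Set (o ⊔ ℓ)
  NaturalToId j = ∀ {A B} (f : Hom A B) → f ∘ j A ≡ j B ∘ S₁ f

  slide : ∀ {j} → NaturalToId j → ∀ {W X Y} {f : Hom X Y} {g : Hom W (S₀ X)} →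
          j Y ∘ (S₁ f ∘ g) ≡ f ∘ (j X ∘ g)
  slide {j} nat {X = X} {Y} {f} {g} = begin
    j Y ∘ (S₁ f ∘ g) ≡⟨ sym assoc ⟩
    (j Y ∘ S₁ f) ∘ g ≡⟨ cong (_∘ g) (sym (nat f)) ⟩
    (f ∘ j X) ∘ g    ≡⟨ assoc ⟩
    f ∘ (j X ∘ g)    ∎

  summable-resp : ∀ {X Y} {f₀ f₁ g₀ g₁ : Hom X Y} →
                  f₀ ≡ g₀ → f₁ ≡ g₁ → Summable f₀ f₁ → Summable g₀ g₁
  summable-resp f₀≡g₀ f₁≡g₁ (w , e₀ , e₁) = w , trans e₀ f₀≡g₀ , trans e₁ f₁≡g₁

  ∘-summable : ∀ {X Y Z} {f₀ f₁ : Hom X Y} (h : Hom Y Z) →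
               Summable f₀ f₁ → Summable (h ∘ f₀) (h ∘ f₁)
  ∘-summable h (w , e₀ , e₁) =
    S₁ h ∘ w , trans (slide π₀-nat) (cong (h ∘_) e₀)
             , trans (slide π₁-nat) (cong (h ∘_) e₁)

  summable-∘ : ∀ {W X Y} {f₀ f₁ : Hom X Y} →
               Summable f₀ f₁ → (g : Hom W X) → Summable (f₀ ∘ g) (f₁ ∘ g)
  summable-∘ (w , e₀ , e₁) g =
    w ∘ g , trans (sym assoc) (cong (_∘ g) e₀)
          , trans (sym assoc) (cong (_∘ g) e₁)

  sum-unique : ∀ {X Y} {f₀ f₁ : Hom X Y} (p q : Summable f₀ f₁) → sum p ≡ sum q
  sum-unique {Y = Y} (w , e₀ , e₁) (v , d₀ , d₁) =
    cong (σ Y ∘_) (jointly-monic (trans e₀ (sym d₀)) (trans e₁ (sym d₁)))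

  sum-∘ : ∀ {X Y Z} {f₀ f₁ : Hom X Y} (h : Hom Y Z) (p : Summable f₀ f₁) →
          sum (∘-summable h p) ≡ h ∘ sum p
  sum-∘ h p = slide σ-nat

module SummabilityProperties {o ℓ} {𝓛 : PointedCategory o ℓ}
                             (Σ𝓛 : Summability 𝓛) where
  open PointedCategory 𝓛
  open Summability Σ𝓛
  open PreSummability pre
  open PreSummabilityProperties pre

  transpose-summable : ∀ Y → Summable (S₁ (π₀ Y)) (S₁ (π₁ Y))
  transpose-summable Y =
    S-witness (row (π₀ Y)) (row (π₁ Y)) (σ (S₀ Y) , σ-nat (π₀ Y) , σ-nat (π₁ Y))
    where
    row : (f : Hom (S₀ Y) Y) → Summable (f ∘ π₀ (S₀ Y)) (f ∘ π₁ (S₀ Y))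
    row f = S₁ f , sym (π₀-nat f) , sym (π₁-nat f)

  transpose : ∀ Y → Hom (S₀ (S₀ Y)) (S₀ (S₀ Y))
  transpose Y = witness (transpose-summable Y)

  S₁σ∘transpose : ∀ Y → S₁ (σ Y) ∘ transpose Y ≡ σ (S₀ Y)
  S₁σ∘transpose Y with transpose-summable Y
  ... | c , c₀ , c₁ =
    S-assoc Y c (swap π₀ π₀ π₀-nat c₀) (swap π₀ π₁ π₀-nat c₁)
                (swap π₁ π₀ π₁-nat c₀) (swap π₁ π₁ π₁-nat c₁)
    where
    swap : ∀ i j → NaturalToId i → j (S₀ Y) ∘ c ≡ S₁ (j Y) →
           i Y ∘ j (S₀ Y) ∘ c ≡ j Y ∘ i (S₀ Y)
    swap i j nat cⱼ = trans (cong (i Y ∘_) cⱼ) (sym (nat (j Y)))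

mainTheorem1 : ∀ {o ℓ} (𝓛 : PointedCategory o ℓ) (Σ𝓛 : Summability 𝓛) →
    let open PointedCategory 𝓛
        open Summability Σ𝓛
        open PreSummability pre
    in ∀ {X Y} {f₀₀ f₀₁ f₁₀ f₁₁ : Hom X Y}
       (p₀ : Summable f₀₀ f₀₁) (p₁ : Summable f₁₀ f₁₁)
       (p : Summable (sum p₀) (sum p₁)) →
       Σ (Summable f₀₀ f₁₀) λ q₀ →
       Σ (Summable f₀₁ f₁₁) λ q₁ →
       Σ (Summable (sum q₀) (sum q₁)) λ q →
       sum p ≡ sum q
mainTheorem1 𝓛 Σ𝓛 {X} {Y} {f₀₀} {f₀₁} {f₁₀} {f₁₁} p₀@(_ , e₀₀ , e₀₁) p₁@(_ , e₁₀ , e₁₁) p =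
  q₀ , q₁ , q , sums-agree
  where
  open PointedCategory 𝓛
  open Summability Σ𝓛
  open PreSummability pre
  open PreSummabilityProperties pre
  open SummabilityProperties Σ𝓛
  open ≡-Reasoning

  rows : Summable (witness p₀) (witness p₁)
  rows = S-witness p₀ p₁ p

  W : Hom X (S₀ (S₀ Y))
  W = witness rows

  q₀ : Summable f₀₀ f₁₀
  q₀ = summable-resp e₀₀ e₁₀ (∘-summable (π₀ Y) rows)

  q₁ : Summable f₀₁ f₁₁
  q₁ = summable-resp e₀₁ e₁₁ (∘-summable (π₁ Y) rows)

  q : Summable (sum q₀) (sum q₁)
  q = ∘-summable (σ Y) (summable-∘ (transpose-summable Y) W)

  sums-agree : sum p ≡ sum q
  sums-agree = begin
    sum p                                ≡⟨ sum-unique p (∘-summable (σ Y) rows) ⟩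
    σ Y ∘ (S₁ (σ Y) ∘ W)                 ≡⟨ sum-∘ (σ Y) rows ⟩
    σ Y ∘ (σ (S₀ Y) ∘ W)                 ≡⟨ cong (λ h → σ Y ∘ (h ∘ W)) (sym (S₁σ∘transpose Y)) ⟩
    σ Y ∘ ((S₁ (σ Y) ∘ transpose Y) ∘ W) ≡⟨ cong (σ Y ∘_) assoc ⟩
    σ Y ∘ (S₁ (σ Y) ∘ (transpose Y ∘ W)) ∎
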